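{- Let $V$ be a set and let $\mathcal{B}\subseteq V^3$ be a ternary relation on $V$ (write $abc$ for the triple $(a,b,c)$) satisfying the axioms: (B) for all pairwise distinct $a,b,c\in V$, $\mathcal{B}$ contains at least one of $abc,acb,bac,bca,cab,cba$; (C) for all $a,b,c\in V$, $abc\in\mathcal{B}$ implies $acb\notin\mathcal{B}$; (D) for all $a,b,c\in V$, $abc\in\mathcal{B}$ implies $a,b,c$ are pairwise distinct; (F) for all $a,b,c\in V$, $abc\in\mathcal{B}$ implies $bca\in\mathcal{B}$ or $cba\in\mathcal{B}$. Then: (L) for all $a,b,c\in V$, if $abc\in\mathcal{B}$ then $\mathcal{B}\cap\{a,b,c\}^3\in\{\{abc,cba\},\{abc,bca,cab\}\}$; (G) for all pairwise distinct $a,b,c\in V$, if $abc\notin\mathcal{B}$ then $bac\in\mathcal{B}$ or $acb\in\mathcal{B}$; (C') for all $a,b,c\in V$, if $abc\in\mathcal{B}$ then $bac\notin\mathcal{B}$. Moreover, if $\mathcal{B}$ additionally satisfies (2) for all $a,b,c,x\in V$, $abc\in\mathcal{B}$ and $bxc\in\mathcal{B}$ imply $abx\in\mathcal{B}$, then $\mathcal{B}$ also satisfies: (3) for all $a,b,c,x\in V$, $abc\in\mathcal{B}$ and $bxc\in\mathcal{B}$ imply $axc\in\mathcal{B}$; (2') for all $a,b,c,x\in V$, $abc\in\mathcal{B}$ and $axb\in\mathcal{B}$ imply $axc\in\mathcal{B}$; (3') for all $a,b,c,x\in V$, $abc\in\mathcal{B}$ and $axb\in\mathcal{B}$ imply 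$xbc\in\mathcal{B}$.
   Context: A ternary relation on a set $V$ is a subset $\mathcal{B}\subseteq V\times V\times V$; the triple $(a,b,c)$ is written $abc$. -}

module Defs where

open import Level using (Level; _⊔_; suc)
open import Data.Product using (_×_; _,_)
open import Data.Sum using (_⊎_)
open import Relation.Binary.PropositionalEquality using (_≡_)
open import Relation.Nullary using (¬_)

TernRel : ∀ {v} (V : Set v) (ℓ : Level) → Set (v ⊔ suc ℓ)
TernRel V ℓ = V → V → V → Set ℓ

module _ {v ℓ} {V : Set v} (B : TernRel V ℓ) where

  Distinct3 : V → V → V → Set v
  Distinct3 a b c = ¬ a ≡ b × ¬ a ≡ c × ¬ b ≡ c

  AxB : Set (v ⊔ ℓ)
  AxB = ∀ a b c → Distinct3 a b c →
        B a b c ⊎ B a c b ⊎ B b a c ⊎ B b c a ⊎ B c a b ⊎ B c b a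

  AxC : Set (v ⊔ ℓ)
  AxC = ∀ a b c → B a b c → ¬ B a c b

  AxD : Set (v ⊔ ℓ)
  AxD = ∀ a b c → B a b c → Distinct3 a b c

  AxF : Set (v ⊔ ℓ)
  AxF = ∀ a b c → B a b c → B b c a ⊎ B c b a

  In3 : V → V → V → V → Set v
  In3 a b c x = x ≡ a ⊎ x ≡ b ⊎ x ≡ c

  TriEq : V → V → V → V → V → V → Set v
  TriEq x y z p q r = x ≡ p × y ≡ q × z ≡ r

  RestrictEq : V → V → V → (V → V → V → Set v) → Set (v ⊔ ℓ)
  RestrictEq a b c S = ∀ x y z → In3 a b c x → In3 a b c y → In3 a b c z →
                       (B x y z → S x y z) × (S x y z → B x y z)

  Two : V → V → V → V → V → V → Set v
  Two a b c x y z = TriEq x y z a b c ⊎ TriEq x y z c b a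

  Three : V → V → V → V → V → V → Set v
  Three a b c x y z = TriEq x y z a b c ⊎ TriEq x y z b c a ⊎ TriEq x y z c a b

  AxL : Set (v ⊔ ℓ)
  AxL = ∀ a b c → B a b c →
        RestrictEq a b c (Two a b c) ⊎ RestrictEq a b c (Three a b c)

  AxG : Set (v ⊔ ℓ)
  AxG = ∀ a b c → Distinct3 a b c → ¬ B a b c → B b a c ⊎ B a c b

  AxC' : Set (v ⊔ ℓ)
  AxC' = ∀ a b c → B a b c → ¬ B b a c

  Ax2 : Set (v ⊔ ℓ)
  Ax2 = ∀ a b c x → B a b c → B b x c → B a b x

  Ax3 : Set (v ⊔ ℓ)
  Ax3 = ∀ a b c x → B a b c → B b x c → B a x c

  Ax2' : Set (v ⊔ ℓ)
  Ax2' = ∀ a b c x → B a b c → B a x b → B a x c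

  Ax3' : Set (v ⊔ ℓ)
  Ax3' = ∀ a b c x → B a b c → B a x b → B x b c

{-# OPTIONS --safe #-}
module Submission where

-- By (C) and (F), a triple abc of 𝓑 is either reversed (cba ∈ 𝓑) or rotated
-- (bca, cab ∈ 𝓑); with (D) this pins down 𝓑 on {a,b,c}, which is (L), and with (B)
-- it puts one of abc, bac, acb in 𝓑, which is (G). Under (2), the remaining
-- properties live on the four points a, b, c, x: decide the relevant triples with
-- these two facts, and refute each wrong case by (2) followed by (C) or (C').
-- Finally (3') follows from (2) and (3).

open import Defs
open import Data.Product using (_×_; _,_; proj₁; proj₂)
open import Data.Sum using (_⊎_; inj₁; inj₂)
open import Data.Empty using (⊥-elim)
open import Relation.Nullary using (¬_)
open import Relation.Binary.PropositionalEquality using (_≡_; refl; ≢-sym)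

module _ {v ℓ} {V : Set v} (B : TernRel V ℓ) where

  private
    variable
      a b c x y z : V

  data Arrangement (a b c : V) : V → V → V → Set v where
    π123 : Arrangement a b c a b c
    π132 : Arrangement a b c a c b
    π213 : Arrangement a b c b a c
    π231 : Arrangement a b c b c a
    π312 : Arrangement a b c c a b
    π321 : Arrangement a b c c b a

  arrange : In3 B a b c x → In3 B a b c y → In3 B a b c z →
            Distinct3 B x y z → Arrangement a b c x y z
  arrange (inj₁ refl)        (inj₂ (inj₁ refl)) (inj₂ (inj₂ refl)) _             = π123
  arrange (inj₁ refl)        (inj₂ (inj₂ refl)) (inj₂ (inj₁ refl)) _             = π132
  arrange (inj₂ (inj₁ refl)) (inj₁ refl)        (inj₂ (inj₂ refl)) _             = π213
  arrange (inj₂ (inj₁ refl)) (inj₂ (inj₂ refl)) (inj₁ refl)        _             = π231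
  arrange (inj₂ (inj₂ refl)) (inj₁ refl)        (inj₂ (inj₁ refl)) _             = π312
  arrange (inj₂ (inj₂ refl)) (inj₂ (inj₁ refl)) (inj₁ refl)        _             = π321
  arrange (inj₁ refl)        (inj₁ refl)        _                  (x≢y , _)     = ⊥-elim (x≢y refl)
  arrange (inj₂ (inj₁ refl)) (inj₂ (inj₁ refl)) _                  (x≢y , _)     = ⊥-elim (x≢y refl)
  arrange (inj₂ (inj₂ refl)) (inj₂ (inj₂ refl)) _                  (x≢y , _)     = ⊥-elim (x≢y refl)
  arrange (inj₁ refl)        _                  (inj₁ refl)        (_ , x≢z , _) = ⊥-elim (x≢z refl)
  arrange (inj₂ (inj₁ refl)) _                  (inj₂ (inj₁ refl)) (_ , x≢z , _) = ⊥-elim (x≢z refl)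
  arrange (inj₂ (inj₂ refl)) _                  (inj₂ (inj₂ refl)) (_ , x≢z , _) = ⊥-elim (x≢z refl)
  arrange _                  (inj₁ refl)        (inj₁ refl)        (_ , _ , y≢z) = ⊥-elim (y≢z refl)
  arrange _                  (inj₂ (inj₁ refl)) (inj₂ (inj₁ refl)) (_ , _ , y≢z) = ⊥-elim (y≢z refl)
  arrange _                  (inj₂ (inj₂ refl)) (inj₂ (inj₂ refl)) (_ , _ , y≢z) = ⊥-elim (y≢z refl)

  module _ (axC : AxC B) (axF : AxF B) where

    asym₂₃ : B a b c → ¬ B a c b
    asym₂₃ = axC _ _ _

    asym₁₂ : B a b c → ¬ B b a c
    asym₁₂ abc bac with axF _ _ _ abc
    ... | inj₁ bca = asym₂₃ bac bca
    ... | inj₂ cba with axF _ _ _ bac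
    ...   | inj₁ acb = asym₂₃ abc acb
    ...   | inj₂ cab = asym₂₃ cab cba

    rotate : B a b c → B b c a → B c a b
    rotate abc bca with axF _ _ _ bca
    ... | inj₁ cab = cab
    ... | inj₂ acb = ⊥-elim (asym₂₃ abc acb)

    reverse-or-rotate : B a b c → B c b a ⊎ B b c a × B c a b
    reverse-or-rotate abc with axF _ _ _ abc
    ... | inj₁ bca = inj₂ (bca , rotate abc bca)
    ... | inj₂ cba = inj₁ cba

    module _ (axD : AxD B) where

      restrictEq : {S : V → V → V → Set v} →
                   (∀ {x y z} → Arrangement a b c x y z → B x y z → S x y z) →
                   (∀ {x y z} → S x y z → B x y z) →
                   RestrictEq B a b c S
      restrictEq B⇒S S⇒B x y z ix iy iz =
        (λ xyz → B⇒S (arrange ix iy iz (axD x y z xyz)) xyz) , S⇒B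

      axL : AxL B
      axL a b c abc with reverse-or-rotate abc
      ... | inj₁ cba = inj₁ (restrictEq B⇒Two Two⇒B)
        where
        B⇒Two : Arrangement a b c x y z → B x y z → Two B a b c x y z
        B⇒Two π123 _   = inj₁ (refl , refl , refl)
        B⇒Two π321 _   = inj₂ (refl , refl , refl)
        B⇒Two π132 acb = ⊥-elim (asym₂₃ abc acb)
        B⇒Two π213 bac = ⊥-elim (asym₁₂ abc bac)
        B⇒Two π231 bca = ⊥-elim (asym₁₂ cba bca)
        B⇒Two π312 cab = ⊥-elim (asym₂₃ cba cab)

        Two⇒B : Two B a b c x y z → B x y z
        Two⇒B (inj₁ (refl , refl , refl)) = abc
        Two⇒B (inj₂ (refl , refl , refl)) = cba
      ... | inj₂ (bca , cab) = inj₂ (restrictEq B⇒Three Three⇒B)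
        where
        B⇒Three : Arrangement a b c x y z → B x y z → Three B a b c x y z
        B⇒Three π123 _   = inj₁ (refl , refl , refl)
        B⇒Three π231 _   = inj₂ (inj₁ (refl , refl , refl))
        B⇒Three π312 _   = inj₂ (inj₂ (refl , refl , refl))
        B⇒Three π132 acb = ⊥-elim (asym₂₃ abc acb)
        B⇒Three π213 bac = ⊥-elim (asym₁₂ abc bac)
        B⇒Three π321 cba = ⊥-elim (asym₁₂ bca cba)

        Three⇒B : Three B a b c x y z → B x y z
        Three⇒B (inj₁ (refl , refl , refl))        = abc
        Three⇒B (inj₂ (inj₁ (refl , refl , refl))) = bca
        Three⇒B (inj₂ (inj₂ (refl , refl , refl))) = cab

    module _ (axB : AxB B) where

      total : ∀ a b c → Distinct3 B a b c → B a b c ⊎ B b a c ⊎ B a c b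
      total a b c d with axB a b c d
      ... | inj₁ abc               = inj₁ abc
      ... | inj₂ (inj₁ acb)        = inj₂ (inj₂ acb)
      ... | inj₂ (inj₂ (inj₁ bac)) = inj₂ (inj₁ bac)
      ... | inj₂ (inj₂ (inj₂ (inj₁ bca))) with reverse-or-rotate bca
      ...   | inj₁ acb       = inj₂ (inj₂ acb)
      ...   | inj₂ (_ , abc) = inj₁ abc
      total a b c d | inj₂ (inj₂ (inj₂ (inj₂ (inj₁ cab)))) with reverse-or-rotate cab
      ...   | inj₁ bac       = inj₂ (inj₁ bac)
      ...   | inj₂ (abc , _) = inj₁ abc
      total a b c d | inj₂ (inj₂ (inj₂ (inj₂ (inj₂ cba)))) with reverse-or-rotate cba
      ...   | inj₁ abc       = inj₁ abc
      ...   | inj₂ (bac , _) = inj₂ (inj₁ bac)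

      axG : AxG B
      axG a b c d ¬abc with total a b c d
      ... | inj₁ abc     = ⊥-elim (¬abc abc)
      ... | inj₂ bac⊎acb = bac⊎acb

      module _ (axD : AxD B) (ax2 : Ax2 B) where

        private
          ⟨2⟩ : B a b c → B b x c → B a b x
          ⟨2⟩ = ax2 _ _ _ _

          ≢₁₂ : B a b c → ¬ a ≡ b
          ≢₁₂ abc = proj₁ (axD _ _ _ abc)

          ≢₁₃ : B a b c → ¬ a ≡ c
          ≢₁₃ abc = proj₁ (proj₂ (axD _ _ _ abc))

          ≢₂₃ : B a b c → ¬ b ≡ c
          ≢₂₃ abc = proj₂ (proj₂ (axD _ _ _ abc))

          axb⇒x≢c : B a b c → B a x b → ¬ x ≡ c
          axb⇒x≢c abc acb refl = asym₂₃ abc acb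

        ax2' : Ax2' B
        ax2' a b c x abc axb with total x a c (≢-sym (≢₁₂ axb) , axb⇒x≢c abc axb , ≢₁₃ abc)
        ... | inj₁ xac        = ⊥-elim (asym₁₂ axb (⟨2⟩ xac abc))
        ... | inj₂ (inj₁ axc) = axc
        ... | inj₂ (inj₂ xca) with reverse-or-rotate abc
        ...   | inj₁ cba = ⟨2⟩ axb (⟨2⟩ xca cba)
        ...   | inj₂ (_ , cab) with reverse-or-rotate xca
        ...     | inj₁ acx       = ⊥-elim (asym₁₂ acx (⟨2⟩ cab axb))
        ...     | inj₂ (_ , axc) = axc

        ax3 : Ax3 B
        ax3 a b c x abc bxc with ⟨2⟩ abc bxc | reverse-or-rotate bxc
        ... | abx | inj₁ cxb with reverse-or-rotate abc
        ...   | inj₁ cba with total x a c (≢-sym (≢₁₃ abx) , ≢₂₃ bxc , ≢₁₃ abc)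
        ...     | inj₁ xac        = ⊥-elim (asym₂₃ (⟨2⟩ cba (⟨2⟩ bxc xac)) cxb)
        ...     | inj₂ (inj₁ axc) = axc
        ...     | inj₂ (inj₂ xca) = ⊥-elim (asym₁₂ cxb (⟨2⟩ xca cba))
        ax3 a b c x abc bxc | abx | inj₁ cxb | inj₂ (bca , _) with reverse-or-rotate abx
        ...     | inj₁ xba       = ⊥-elim (asym₁₂ bxc (⟨2⟩ xba bca))
        ...     | inj₂ (_ , xab) = ⊥-elim (asym₂₃ bxc (⟨2⟩ bca (⟨2⟩ cxb xab)))
        ax3 a b c x abc bxc | abx | inj₂ (xcb , cbx) with total a c x (≢₁₃ abc , ≢₁₃ abx , ≢-sym (≢₂₃ bxc))
        ...   | inj₁ acx        = ⊥-elim (asym₂₃ abc (⟨2⟩ acx cbx))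
        ...   | inj₂ (inj₂ axc) = axc
        ...   | inj₂ (inj₁ cax) with reverse-or-rotate cax
        ...     | inj₁ xac       = ⊥-elim (asym₂₃ xac (⟨2⟩ xcb (⟨2⟩ cax abx)))
        ...     | inj₂ (axc , _) = axc

        ax3' : Ax3' B
        ax3' a b c x abc axb with total x b c (≢₂₃ axb , axb⇒x≢c abc axb , ≢₂₃ abc)
        ... | inj₁ xbc        = xbc
        ... | inj₂ (inj₁ bxc) = ⊥-elim (asym₂₃ axb (⟨2⟩ abc bxc))
        ... | inj₂ (inj₂ xcb) = ⊥-elim (asym₂₃ abc (ax3 a x b c axb xcb))

proposition1 : ∀ {v ℓ} {V : Set v} (B : TernRel V ℓ) →
    AxB B → AxC B → AxD B → AxF B →
    (AxL B × AxG B × AxC' B) × (Ax2 B → Ax3 B × Ax2' B × Ax3' B)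
proposition1 B axB axC axD axF =
  (axL B axC axF axD , axG B axC axF axB , λ _ _ _ → asym₁₂ B axC axF) ,
  λ ax2 → ax3 B axC axF axB axD ax2 , ax2' B axC axF axB axD ax2 , ax3' B axC axF axB axD ax2
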